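{- Let $\mathcal{M}=\{P_1,\dots,P_n\}$ be a projective $[n,k,d]_q$ system and let $G=(\mathcal{M},E)$ be a graph with vertex set $\mathcal{M}$ and integrity $\iota(G)\ge n-d+1$. Then the set of lines $\mathcal{L}(\mathcal{M},G)=\{\langle P_i,P_j\rangle: P_iP_j\in E\}$ satisfies the avoidance property, and the point set $\mathcal{B}(\mathcal{M},G)=\bigcup_{\ell\in\mathcal{L}(\mathcal{M},G)}\ell$ is a strong blocking set in $\mathrm{PG}(k-1,q)$ of size at most $n+(q-1)|E|$.
   Context: $q$ is a prime power and $\mathrm{PG}(k-1,q)$ is the projective space of $1$-dimensional subspaces of $\mathbb{F}_q^k$; $\langle\cdot\rangle$ denotes projective span. A projective $[n,k,d]_q$ system is a set of $n$ points $\mathcal{M}\subseteq\mathrm{PG}(k-1,q)$ spanning $\mathrm{PG}(k-1,q)$ such that $d=n-\max\{|H\cap\mathcal{M}|: H \text{ a hyperplane}\}$. For a graph $H$, $\kappa(H)$ is the largest size of a connected component (0 for the empty graph), and the integrity of $G=(V,E)$ is $\iota(G)=\min_{S\subseteq V}(|S|+\kappa(G-S))$. A set of lines satisfies the avoidance property if no codimension-$2$ subspace meets every line of the set. A set $\mathcal{B}$ of points is a strong blocking set if for every hyperplane $H$, $\langle H\cap\mathcal{B}\rangle=H$. -}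

module Defs where

open import Level using (Level; _⊔_) renaming (suc to lsuc)
open import Algebra.Bundles using (CommutativeRing)
open import Data.Nat as ℕ using (ℕ; zero; suc)
open import Data.Fin as Fin using (Fin; zero; suc; toℕ)
open import Data.Fin.Subset using (Subset; _∈_; _∉_; ∣_∣)
open import Data.Bool using (Bool; T)
open import Data.List using (List; length; filter; concatMap; map)
open import Data.List.Base using (allFin)
open import Data.Product using (Σ; ∃; _×_; _,_)
open import Data.Sum using (_⊎_)
open import Relation.Nullary using (¬_)
open import Relation.Nullary.Decidable using (_×-dec_)
open import Relation.Binary.Core using (Rel)
open import Relation.Binary.Definitions using (Decidable)
open import Relation.Binary.PropositionalEquality using (_≡_)
open import Relation.Binary.Construct.Closure.ReflexiveTransitive using (Star)

record FiniteField (c ℓ : Level) : Set (lsuc (c ⊔ ℓ)) where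
  field
    commRing : CommutativeRing c ℓ
  open CommutativeRing commRing public
  field
    1≉0      : ¬ (1# ≈ 0#)
    inverse  : ∀ x → ¬ (x ≈ 0#) → ∃ λ y → (x * y) ≈ 1#
    _≟_      : Decidable _≈_
    q        : ℕ
    enum     : Fin q → Carrier
    enum-surj : ∀ x → ∃ λ i → enum i ≈ x
    enum-inj  : ∀ i j → enum i ≈ enum j → i ≡ j

-- Simple graphs on the vertex set Fin n (vertex i stands for P_i).

record Graph (n : ℕ) : Set where
  field
    adj     : Fin n → Fin n → Bool
    adj-sym : ∀ i j → adj i j ≡ adj j i
    irrefl  : ∀ i → adj i i ≡ Data.Bool.false

open Graph public

edgeList : ∀ {n} → Graph n → List (Fin n Data.Product.× Fin n)
edgeList {n} G =
  filter (λ p → (Data.Product.proj₁ p Fin.<? Data.Product.proj₂ p)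
                  ×-dec Data.Bool.Properties.T? (adj G (Data.Product.proj₁ p) (Data.Product.proj₂ p)))
         (concatMap (λ i → map (λ j → (i , j)) (allFin n)) (allFin n))
  where import Data.Bool.Properties

numEdges : ∀ {n} → Graph n → ℕ
numEdges G = length (edgeList G)

StepOutside : ∀ {n} → Graph n → Subset n → Rel (Fin n) Level.zero
StepOutside G S i j = i ∉ S × j ∉ S × T (adj G i j)

InComponent : ∀ {n} → Graph n → Subset n → Fin n → Fin n → Set
InComponent G S v u = v ∉ S × Star (StepOutside G S) v u

-- κ(G - S) ≥ t : t = 0, or some connected component of G - S has
-- at least t vertices
KappaAtLeast : ∀ {n} → Graph n → Subset n → ℕ → Set
KappaAtLeast {n} G S t =
  t ≡ 0 ⊎ Σ (Fin n) λ v → Σ (Subset n) λ C →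
            (t ℕ.≤ ∣ C ∣) × (∀ u → u ∈ C → InComponent G S v u)

IntegrityAtLeast : ∀ {n} → Graph n → ℕ → Set
IntegrityAtLeast {n} G m =
  ∀ (S : Subset n) → ∃ λ t → (m ℕ.≤ ∣ S ∣ ℕ.+ t) × KappaAtLeast G S t

-- A point is represented by a non-zero vector of F^k; a set of points
-- is a predicate on vectors (closed under non-zero scalars).

module Projective {c : Level} (F : FiniteField c c) where
  open FiniteField F hiding (zero)

  Vector : ℕ → Set c
  Vector k = Fin k → Carrier

  _≈ᵥ_ : ∀ {k} → Vector k → Vector k → Set c
  x ≈ᵥ y = ∀ t → x t ≈ y t

  0ᵥ : ∀ {k} → Vector k
  0ᵥ _ = 0#

  _+ᵥ_ : ∀ {k} → Vector k → Vector k → Vector k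
  (x +ᵥ y) t = x t + y t

  _·ᵥ_ : ∀ {k} → Carrier → Vector k → Vector k
  (α ·ᵥ x) t = α * x t

  ∑ : ∀ {m} → (Fin m → Carrier) → Carrier
  ∑ {zero}  f = 0#
  ∑ {suc m} f = f zero + ∑ (λ i → f (suc i))

  dot : ∀ {k} → Vector k → Vector k → Carrier
  dot a x = ∑ (λ t → a t * x t)

  IsPoint : ∀ {k} → Vector k → Set c
  IsPoint x = ¬ (x ≈ᵥ 0ᵥ)

  SamePoint : ∀ {k} → Vector k → Vector k → Set c
  SamePoint x y = ∃ λ α → y ≈ᵥ (α ·ᵥ x)

  PointSet : ℕ → Set (lsuc c)
  PointSet k = Vector k → Set c

  InSpanFam : ∀ {k m} → (Fin m → Vector k) → Vector k → Set c
  InSpanFam {k} {m} ys x =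
    ∃ λ (cs : Fin m → Carrier) → x ≈ᵥ (λ t → ∑ (λ i → cs i * ys i t))

  InSpan : ∀ {k} → PointSet k → Vector k → Set c
  InSpan {k} S x =
    Σ ℕ λ m → Σ (Fin m → Vector k) λ ys → (∀ i → S (ys i)) × InSpanFam ys x

  HyperplanePt : ∀ {k} → Vector k → PointSet k
  HyperplanePt a x = IsPoint x × (dot a x ≈ 0#)

  LinIndep : ∀ {k} → Vector k → Vector k → Set c
  LinIndep a b = ∀ α β → ((α ·ᵥ a) +ᵥ (β ·ᵥ b)) ≈ᵥ 0ᵥ → (α ≈ 0#) × (β ≈ 0#)

  Codim2Pt : ∀ {k} → Vector k → Vector k → PointSet k
  Codim2Pt a b x = IsPoint x × (dot a x ≈ 0#) × (dot b x ≈ 0#)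

  LinePt : ∀ {k} → Vector k → Vector k → PointSet k
  LinePt P Q x = IsPoint x × ∃ λ α → ∃ λ β → x ≈ᵥ ((α ·ᵥ P) +ᵥ (β ·ᵥ Q))

  Meets : ∀ {k} → PointSet k → PointSet k → Set c
  Meets A B = ∃ λ x → A x × B x

  Avoidance : ∀ {k} {I : Set} → (I → PointSet k) → Set c
  Avoidance {k} {I} L =
    ∀ (a b : Vector k) → LinIndep a b → ∃ λ (e : I) → ¬ Meets (L e) (Codim2Pt a b)

  StrongBlocking : ∀ {k} → PointSet k → Set c
  StrongBlocking {k} B =
    ∀ (a : Vector k) → IsPoint a → ∀ x → HyperplanePt a x →
      InSpan (λ y → B y × HyperplanePt a y) x

  AtMostPoints : ∀ {k} → PointSet k → ℕ → Set c
  AtMostPoints {k} B N =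
    ∃ λ (reps : Fin N → Vector k) → ∀ x → B x → ∃ λ i → SamePoint (reps i) x

  hypCount : ∀ {n k} → (Fin n → Vector k) → Vector k → ℕ
  hypCount {n} P a = length (filter (λ i → dot a (P i) ≟ 0#) (allFin n))

  record ProjSystem (n k d : ℕ) (P : Fin n → Vector k) : Set c where
    field
      points   : ∀ i → IsPoint (P i)
      distinct : ∀ i j → ¬ (i ≡ j) → ¬ SamePoint (P i) (P j)
      spanning : ∀ x → IsPoint x → InSpanFam P x
      -- d = n - max_H |H ∩ M|
      maxBound : ∀ a → IsPoint a → hypCount P a ℕ.+ d ℕ.≤ n
      maxAttained : ∃ λ a → IsPoint a × (hypCount P a ℕ.+ d ≡ n)

  Edge : ∀ {n} → Graph n → Set
  Edge {n} G = Σ (Fin n) λ i → Σ (Fin n) λ j → T (adj G i j)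

  lines : ∀ {n k} → (Fin n → Vector k) → (G : Graph n) → Edge G → PointSet k
  lines P G (i , j , _) = LinePt (P i) (P j)

  blockSet : ∀ {n k} → (Fin n → Vector k) → Graph n → PointSet k
  blockSet P G x = ∃ λ e → lines P G e x

open Projective public

{-# OPTIONS --safe #-}
-- Let a, b be independent functionals and π i = (a·P_i , b·P_i).  If every edge line
-- met the axis {a = b = 0}, then π i ∥ π j (proportional) on every edge, so π is constant up to
-- scalars along each component C of G − S, where S = {i : π i = 0}.  For v ∈ C the functional
-- (b·P_v) a − (a·P_v) b of the pencil is non-zero and vanishes on S ∪ C, hence |S| + |C| ≤ n − d,
-- contradicting ι(G) ≥ n − d + 1.
--
-- Each line meets a hyperplane H = {a = 0} in a point; if these points did not
-- span H, a functional b vanishing on all of them but not on some point of H would give an axis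
-- {a = b = 0} met by every line.  Size: the line ⟨P_i, P_j⟩ consists of P_i, P_j and the q − 1
-- points P_j + γ P_i with γ ≠ 0.
module Submission where

open import Data.Bool using (true; false; T)
open import Data.Bool.Properties using (T?)
open import Data.Empty using (⊥-elim)
open import Data.Fin as Fin using (Fin; zero; suc; _↑ˡ_; _↑ʳ_)
open import Data.Fin.Properties using (any?; <-cmp; punchIn-punchOut; remQuot-combine)
open import Data.Fin.Subset using (Subset; _∈_; _∉_; _∪_; _∩_; ∣_∣; Empty)
open import Data.Fin.Subset.Properties using (x∈p∩q⁻; x∈p∪q⁻)
open import Data.List as List using (List; length; filter; tabulate)
open import Data.List.Membership.Propositional using () renaming (_∈_ to _∈ₗ_)
open import Data.List.Membership.Propositional.Properties
  using (∈-filter⁺; ∈-filter⁻; ∈-concatMap⁺; ∈-map⁺; ∈-allFin; ∈-lookup)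
open import Data.List.Relation.Unary.Any using (index) renaming (map to mapAny)
open import Data.List.Relation.Unary.Any.Properties using (lookup-index)
open import Data.Nat as ℕ using (ℕ; suc; _≤_; _∸_; z≤n; s≤s)
import Data.Nat.Properties as ℕₚ
open ℕₚ using (m≤n⇒m≤1+n; ≤-trans; ≤⇒≯; +-monoʳ-≤; m+n≤o⇒m≤o∸n)
open import Data.Product using (∃; _×_; _,_; proj₁; proj₂; swap; uncurry)
open import Data.Sum using (_⊎_; inj₁; inj₂; [_,_]′)
open import Data.Vec using ([]; _∷_; here; there)
import Data.Vec.Functional as VF
open import Data.Vec.Functional.Properties using (lookup-++ˡ; lookup-++ʳ)
open import Function using (_∘_; id; flip)
open import Level using (Level)
open import Relation.Binary.Core using (Rel)
open import Relation.Binary.Construct.Closure.ReflexiveTransitive using (Star; fold)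
open import Relation.Binary.Definitions using (tri<; tri≈; tri>)
import Relation.Binary.PropositionalEquality as ≡
open ≡ using (_≡_; _≢_)
open import Relation.Nullary using (¬_; Dec; yes; no; does)
open import Relation.Nullary.Decidable using (_×-dec_; ¬?; decidable-stable)
open import Relation.Unary using (Pred; Decidable; _⊆_; _≐_)

import Defs
open Defs using (FiniteField; Graph; adj; adj-sym; irrefl; edgeList; numEdges;
                 StepOutside; InComponent; IntegrityAtLeast; module Projective)

Empty-∩⁻ : ∀ {n} x y {p q : Subset n} → Empty ((x ∷ p) ∩ (y ∷ q)) → Empty (p ∩ q)
Empty-∩⁻ _ _ disjoint (i , i∈p∩q) = disjoint (suc i , there i∈p∩q)

∣p∪q∣≡∣p∣+∣q∣ : ∀ {n} (p q : Subset n) → Empty (p ∩ q) → ∣ p ∪ q ∣ ≡ ∣ p ∣ ℕ.+ ∣ q ∣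
∣p∪q∣≡∣p∣+∣q∣ []          []          _        = ≡.refl
∣p∪q∣≡∣p∣+∣q∣ (true  ∷ p) (true  ∷ q) disjoint = ⊥-elim (disjoint (zero , here))
∣p∪q∣≡∣p∣+∣q∣ (true  ∷ p) (false ∷ q) disjoint =
  ≡.cong suc (∣p∪q∣≡∣p∣+∣q∣ p q (Empty-∩⁻ true false disjoint))
∣p∪q∣≡∣p∣+∣q∣ (false ∷ p) (true  ∷ q) disjoint =
  ≡.trans (≡.cong suc (∣p∪q∣≡∣p∣+∣q∣ p q (Empty-∩⁻ false true disjoint)))
          (≡.sym (ℕₚ.+-suc ∣ p ∣ ∣ q ∣))
∣p∪q∣≡∣p∣+∣q∣ (false ∷ p) (false ∷ q) disjoint =
  ∣p∪q∣≡∣p∣+∣q∣ p q (Empty-∩⁻ false false disjoint)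

∣p∣≤length-filter : ∀ {n a ℓ} {A : Set a} {Q : Pred A ℓ} (Q? : Decidable Q) (g : Fin n → A)
                    (p : Subset n) → (∀ {i} → i ∈ p → Q (g i)) →
                    ∣ p ∣ ≤ length (filter Q? (tabulate g))
∣p∣≤length-filter Q? g []      _     = z≤n
∣p∣≤length-filter Q? g (b ∷ p) p⊆Q with Q? (g zero)
∣p∣≤length-filter Q? g (true  ∷ p) p⊆Q | yes _ =
  s≤s (∣p∣≤length-filter Q? (g ∘ suc) p (p⊆Q ∘ there))
∣p∣≤length-filter Q? g (false ∷ p) p⊆Q | yes _ =
  m≤n⇒m≤1+n (∣p∣≤length-filter Q? (g ∘ suc) p (p⊆Q ∘ there))
∣p∣≤length-filter Q? g (true  ∷ p) p⊆Q | no ¬Q = ⊥-elim (¬Q (p⊆Q here))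
∣p∣≤length-filter Q? g (false ∷ p) p⊆Q | no _  = ∣p∣≤length-filter Q? (g ∘ suc) p (p⊆Q ∘ there)

subset : ∀ {n ℓ} {Q : Pred (Fin n) ℓ} → Decidable Q → Subset n
subset {ℕ.zero} Q? = []
subset {suc n}  Q? = does (Q? zero) ∷ subset (Q? ∘ suc)

∈-subset⁺ : ∀ {n ℓ} {Q : Pred (Fin n) ℓ} (Q? : Decidable Q) {i} → Q i → i ∈ subset Q?
∈-subset⁺ Q? {zero} q with Q? zero
... | yes _ = here
... | no ¬q = ⊥-elim (¬q q)
∈-subset⁺ Q? {suc i} q = there (∈-subset⁺ (Q? ∘ suc) q)

∈-subset⁻ : ∀ {n ℓ} {Q : Pred (Fin n) ℓ} (Q? : Decidable Q) {i} → i ∈ subset Q? → Q i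
∈-subset⁻ Q? {zero} i∈Q with Q? zero
∈-subset⁻ Q? {zero} i∈Q | yes q = q
∈-subset⁻ Q? {zero} ()  | no _
∈-subset⁻ Q? {suc i} (there i∈Q) = ∈-subset⁻ (Q? ∘ suc) i∈Q

Star-preserves : ∀ {a r q} {A : Set a} {R : Rel A r} {Q : Pred A q} →
                 (∀ {i j} → R i j → Q i → Q j) → ∀ {i j} → Star R i j → Q i → Q j
Star-preserves {Q = Q} step = fold (λ i j → Q i → Q j) (λ r rest → rest ∘ step r) id

punchedIn : ∀ {a m} {A : Set a} → Fin m → (Fin m → A) → Fin (m ∸ 1) → A
punchedIn {m = suc m} i₀ e = e ∘ Fin.punchIn i₀

punchedIn-covers : ∀ {a m} {A : Set a} (i₀ : Fin m) (e : Fin m → A) {j} → i₀ ≢ j →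
                   ∃ λ k → punchedIn i₀ e k ≡ e j
punchedIn-covers {m = suc m} i₀ e i₀≢j = Fin.punchOut i₀≢j , ≡.cong e (punchIn-punchOut i₀≢j)

lookup-concat : ∀ {a m n} {A : Set a} (xss : Fin n → Fin m → A) i j →
                VF.concat xss (Fin.combine i j) ≡ xss i j
lookup-concat xss i j = ≡.cong (uncurry (flip xss)) (≡.cong swap (remQuot-combine i j))

adj⇒≢ : ∀ {n} (G : Graph n) {i j} → T (adj G i j) → i ≢ j
adj⇒≢ G {i} adj-ii ≡.refl rewrite irrefl G i = adj-ii

∈-edgeList : ∀ {n} (G : Graph n) {i j} → i Fin.< j → T (adj G i j) → (i , j) ∈ₗ edgeList G
∈-edgeList {n} G {i} {j} i<j adj-ij =
  ∈-filter⁺ _ (∈-concatMap⁺ _ (mapAny (λ { ≡.refl → ∈-map⁺ _ (∈-allFin j) }) (∈-allFin i)))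
            (i<j , adj-ij)

edgeList-adj : ∀ {n} (G : Graph n) {i j} → (i , j) ∈ₗ edgeList G → T (adj G i j)
edgeList-adj {n} G e∈E = proj₂ (proj₂ (∈-filter⁻ isEdge? {xs = pairs} e∈E))
  where
  isEdge? : Decidable (λ ((i , j) : Fin n × Fin n) → i Fin.< j × T (adj G i j))
  isEdge? p = (proj₁ p Fin.<? proj₂ p) ×-dec T? (adj G (proj₁ p) (proj₂ p))
  pairs : List (Fin n × Fin n)
  pairs = List.concatMap (λ i → List.map (λ j → (i , j)) (List.allFin n)) (List.allFin n)

InComponent⇒∉ : ∀ {n} (G : Graph n) {S v u} → InComponent G S v u → u ∉ S
InComponent⇒∉ G (v∉S , path) = Star-preserves (λ (_ , j∉S , _) _ → j∉S) path v∉S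

module _ {c : Level} (F : FiniteField c c) where
  open FiniteField F hiding (zero)
  open Projective F
  open import Algebra.Properties.Ring ring using (-‿distribˡ-*)
  open import Algebra.Properties.Group +-group using (x∙y⁻¹≈ε⇒x≈y; x≈y⇒x∙y⁻¹≈ε; ⁻¹-injective; ε⁻¹≈ε)
  open import Algebra.Solver.Ring.NaturalCoefficients.Default commutativeSemiring
  open import Relation.Binary.Reasoning.Setoid setoid

  *-cancelˡ : ∀ {x y z} → ¬ x ≈ 0# → x * y ≈ x * z → y ≈ z
  *-cancelˡ {x} {y} {z} x≉0 xy≈xz with inverse x x≉0
  ... | x⁻¹ , xx⁻¹≈1 = begin
    y               ≈⟨ unit y ⟩
    x⁻¹ * (x * y)   ≈⟨ *-cong refl xy≈xz ⟩
    x⁻¹ * (x * z)   ≈⟨ unit z ⟨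
    z               ∎
    where
    unit : ∀ u → u ≈ x⁻¹ * (x * u)
    unit u = begin
      u               ≈⟨ *-identityˡ u ⟨
      1# * u          ≈⟨ *-cong xx⁻¹≈1 refl ⟨
      (x * x⁻¹) * u   ≈⟨ solve 3 (λ x x⁻¹ u → (x :* x⁻¹) :* u := x⁻¹ :* (x :* u)) refl x x⁻¹ u ⟩
      x⁻¹ * (x * u)   ∎

  *-cancelˡ-≈0 : ∀ {x y} → ¬ x ≈ 0# → x * y ≈ 0# → y ≈ 0#
  *-cancelˡ-≈0 {x} x≉0 xy≈0 = *-cancelˡ x≉0 (trans xy≈0 (sym (zeroʳ x)))

  *-cancelˡ⁻ : ∀ {x y z} → ¬ y ≈ z → x * y ≈ x * z → x ≈ 0#
  *-cancelˡ⁻ {x} y≉z xy≈xz = decidable-stable (x ≟ 0#) (λ x≉0 → y≉z (*-cancelˡ x≉0 xy≈xz))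

  infix 4 _∥_
  _∥_ : Carrier × Carrier → Carrier × Carrier → Set c
  (u₁ , u₂) ∥ (w₁ , w₂) = u₁ * w₂ ≈ w₁ * u₂

  NonzeroPair : Carrier × Carrier → Set c
  NonzeroPair (u₁ , u₂) = ¬ (u₁ ≈ 0# × u₂ ≈ 0#)

  _∥?_ : ∀ u w → Dec (u ∥ w)
  (u₁ , u₂) ∥? (w₁ , w₂) = (u₁ * w₂) ≟ (w₁ * u₂)

  ∥-zero : ∀ u {w₁ w₂} → w₁ ≈ 0# → w₂ ≈ 0# → u ∥ (w₁ , w₂)
  ∥-zero (u₁ , u₂) w₁≈0 w₂≈0 =
    trans (*-cong refl w₂≈0) (trans (zeroʳ u₁) (sym (trans (*-cong w₁≈0 refl) (zeroˡ u₂))))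

  ∥-trans : ∀ {u v w} → NonzeroPair v → u ∥ v → v ∥ w → u ∥ w
  ∥-trans {u₁ , u₂} {v₁ , v₂} {w₁ , w₂} v≉0 u∥v v∥w with v₁ ≟ 0# | v₂ ≟ 0#
  ... | yes v₁≈0 | yes v₂≈0 = ⊥-elim (v≉0 (v₁≈0 , v₂≈0))
  ... | no v₁≉0  | _        = *-cancelˡ v₁≉0 (begin
    v₁ * (u₁ * w₂)  ≈⟨ exchange v₁ u₁ w₂ ⟩
    u₁ * (v₁ * w₂)  ≈⟨ *-cong refl v∥w ⟩
    u₁ * (w₁ * v₂)  ≈⟨ exchange u₁ w₁ v₂ ⟩
    w₁ * (u₁ * v₂)  ≈⟨ *-cong refl u∥v ⟩
    w₁ * (v₁ * u₂)  ≈⟨ exchange w₁ v₁ u₂ ⟩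
    v₁ * (w₁ * u₂)  ∎)
    where
    exchange : ∀ x y z → x * (y * z) ≈ y * (x * z)
    exchange = solve 3 (λ x y z → x :* (y :* z) := y :* (x :* z)) refl
  ... | yes _    | no v₂≉0  = *-cancelˡ v₂≉0 (begin
    v₂ * (u₁ * w₂)  ≈⟨ rot v₂ u₁ w₂ ⟩
    w₂ * (u₁ * v₂)  ≈⟨ *-cong refl u∥v ⟩
    w₂ * (v₁ * u₂)  ≈⟨ rot w₂ v₁ u₂ ⟩
    u₂ * (v₁ * w₂)  ≈⟨ *-cong refl v∥w ⟩
    u₂ * (w₁ * v₂)  ≈⟨ rot u₂ w₁ v₂ ⟩
    v₂ * (w₁ * u₂)  ∎)
    where
    rot : ∀ x y z → x * (y * z) ≈ z * (y * x)
    rot = solve 3 (λ x y z → x :* (y :* z) := z :* (y :* x)) refl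

  -- Cramer's rule: α and β times u₁w₂ − w₁u₂ are combinations of the two equations.
  ¬∥⇒trivialCombination : ∀ {u₁ u₂ w₁ w₂ α β} → ¬ (u₁ , u₂) ∥ (w₁ , w₂) →
                          α * u₁ + β * w₁ ≈ 0# → α * u₂ + β * w₂ ≈ 0# → α ≈ 0# × β ≈ 0#
  ¬∥⇒trivialCombination {u₁} {u₂} {w₁} {w₂} {α} {β} ¬u∥w eq₁ eq₂ =
    *-cancelˡ⁻ ¬u∥w (cancel (begin
      α * (u₁ * w₂) + w₁ * 0#  ≈⟨ +-cong refl (*-cong refl eq₂) ⟨
      α * (u₁ * w₂) + w₁ * (α * u₂ + β * w₂)
        ≈⟨ solve 6 (λ α β u₁ u₂ w₁ w₂ → α :* (u₁ :* w₂) :+ w₁ :* (α :* u₂ :+ β :* w₂)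
                                    := α :* (w₁ :* u₂) :+ w₂ :* (α :* u₁ :+ β :* w₁))
                 refl α β u₁ u₂ w₁ w₂ ⟩
      α * (w₁ * u₂) + w₂ * (α * u₁ + β * w₁)  ≈⟨ +-cong refl (*-cong refl eq₁) ⟩
      α * (w₁ * u₂) + w₂ * 0#  ∎)) ,
    *-cancelˡ⁻ ¬u∥w (cancel (begin
      β * (u₁ * w₂) + u₂ * 0#  ≈⟨ +-cong refl (*-cong refl eq₁) ⟨
      β * (u₁ * w₂) + u₂ * (α * u₁ + β * w₁)
        ≈⟨ solve 6 (λ α β u₁ u₂ w₁ w₂ → β :* (u₁ :* w₂) :+ u₂ :* (α :* u₁ :+ β :* w₁)
                                    := β :* (w₁ :* u₂) :+ u₁ :* (α :* u₂ :+ β :* w₂))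
                 refl α β u₁ u₂ w₁ w₂ ⟩
      β * (w₁ * u₂) + u₁ * (α * u₂ + β * w₂)  ≈⟨ +-cong refl (*-cong refl eq₂) ⟩
      β * (w₁ * u₂) + u₁ * 0#  ∎))
    where
    cancel : ∀ {x y z w} → x + z * 0# ≈ y + w * 0# → x ≈ y
    cancel {x} {y} {z} {w} eq = begin
      x            ≈⟨ solve 2 (λ x z → x := x :+ z :* con 0) refl x z ⟩
      x + z * 0#   ≈⟨ eq ⟩
      y + w * 0#   ≈⟨ solve 2 (λ y w → y :+ w :* con 0 := y) refl y w ⟩
      y            ∎

  ∑-cong : ∀ {m} {f g : Fin m → Carrier} → (∀ i → f i ≈ g i) → ∑ f ≈ ∑ g
  ∑-cong {ℕ.zero}  f≈g = refl
  ∑-cong {ℕ.suc m} f≈g = +-cong (f≈g zero) (∑-cong (f≈g ∘ suc))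

  ∑-zero : ∀ {m} {f : Fin m → Carrier} → (∀ i → f i ≈ 0#) → ∑ f ≈ 0#
  ∑-zero {ℕ.zero}  f≈0 = refl
  ∑-zero {ℕ.suc m} f≈0 = trans (+-cong (f≈0 zero) (∑-zero (f≈0 ∘ suc))) (+-identityʳ 0#)

  ∑-linear : ∀ {m} α β (f g : Fin m → Carrier) →
             ∑ (λ i → α * f i + β * g i) ≈ α * ∑ f + β * ∑ g
  ∑-linear {ℕ.zero} α β f g = solve 2 (λ α β → con 0 := α :* con 0 :+ β :* con 0) refl α β
  ∑-linear {ℕ.suc m} α β f g = begin
    (α * f zero + β * g zero) + ∑ (λ i → α * f (suc i) + β * g (suc i))
      ≈⟨ +-cong refl (∑-linear α β (f ∘ suc) (g ∘ suc)) ⟩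
    (α * f zero + β * g zero) + (α * ∑ (f ∘ suc) + β * ∑ (g ∘ suc))
      ≈⟨ solve 6 (λ α β x y X Y → (α :* x :+ β :* y) :+ (α :* X :+ β :* Y)
                                := α :* (x :+ X) :+ β :* (y :+ Y)) refl α β _ _ _ _ ⟩
    α * ∑ f + β * ∑ g  ∎

  dot-congʳ : ∀ {k} (a : Vector k) {x y : Vector k} → x ≈ᵥ y → dot a x ≈ dot a y
  dot-congʳ a x≈y = ∑-cong (λ t → *-cong refl (x≈y t))

  dot-zeroˡ : ∀ {k} {a : Vector k} (x : Vector k) → a ≈ᵥ 0ᵥ → dot a x ≈ 0#
  dot-zeroˡ x a≈0 = ∑-zero (λ t → trans (*-cong (a≈0 t) refl) (zeroˡ (x t)))

  dot-linearʳ : ∀ {k} (a u w : Vector k) α β →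
                dot a ((α ·ᵥ u) +ᵥ (β ·ᵥ w)) ≈ α * dot a u + β * dot a w
  dot-linearʳ a u w α β = trans
    (∑-cong (λ t → solve 5 (λ a u w α β → a :* (α :* u :+ β :* w) := α :* (a :* u) :+ β :* (a :* w))
                           refl (a t) (u t) (w t) α β))
    (∑-linear α β (λ t → a t * u t) (λ t → a t * w t))

  dot-linearˡ : ∀ {k} (a b x : Vector k) α β →
                dot ((α ·ᵥ a) +ᵥ (β ·ᵥ b)) x ≈ α * dot a x + β * dot b x
  dot-linearˡ a b x α β = trans
    (∑-cong (λ t → solve 5 (λ a b x α β → (α :* a :+ β :* b) :* x := α :* (a :* x) :+ β :* (b :* x))
                           refl (a t) (b t) (x t) α β))
    (∑-linear α β (λ t → a t * x t) (λ t → b t * x t))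

  unitVector : ∀ {k} → Fin k → Vector k
  unitVector zero    zero    = 1#
  unitVector zero    (suc _) = 0#
  unitVector (suc _) zero    = 0#
  unitVector (suc t) (suc s) = unitVector t s

  dot-unitVector : ∀ {k} (t : Fin k) (x : Vector k) → dot (unitVector t) x ≈ x t
  dot-unitVector {ℕ.suc k} zero x = begin
    1# * x zero + ∑ (λ s → 0# * x (suc s))  ≈⟨ +-cong (*-identityˡ _) (∑-zero {k} (λ s → zeroˡ _)) ⟩
    x zero + 0#                             ≈⟨ +-identityʳ _ ⟩
    x zero                                  ∎
  dot-unitVector (suc t) x =
    trans (+-cong (zeroˡ _) (dot-unitVector t (x ∘ suc))) (+-identityˡ _)

  Separates : ∀ {k m} → Vector k → (Fin m → Vector k) → Vector k → Set c
  Separates b ys x = (∀ i → dot b (ys i) ≈ 0#) × ¬ dot b x ≈ 0#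

  private
    sub-cancel : ∀ x z → z + (1# * x + - z) ≈ x
    sub-cancel x z = begin
      z + (1# * x + - z)
        ≈⟨ solve 3 (λ x z n → z :+ (con 1 :* x :+ n) := x :+ (z :+ n)) refl x z (- z) ⟩
      x + (z + - z)       ≈⟨ +-cong refl (-‿inverseʳ z) ⟩
      x + 0#              ≈⟨ +-identityʳ x ⟩
      x                   ∎

  -- One step of Gaussian elimination: b pivots on ys zero.
  inSpan⊎separated-step : ∀ {k m} (ys : Fin (ℕ.suc m) → Vector k) (b : Vector k) →
    (∀ i → dot b (ys (suc i)) ≈ 0#) → ¬ dot b (ys zero) ≈ 0# →
    (∀ x → InSpanFam (ys ∘ suc) x ⊎ ∃ λ b′ → Separates b′ (ys ∘ suc) x) →
    ∀ x → InSpanFam ys x ⊎ ∃ λ b″ → Separates b″ ys x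
  inSpan⊎separated-step {k} ys b b⊥ys′ b·y₀≉0 alternative x with inverse (dot b (ys zero)) b·y₀≉0
  ... | w , b·y₀w≈1 = [ inj₁ ∘ lift , inj₂ ∘ separate ]′ (alternative x′)
    where
    y₀ : Vector k
    y₀ = ys zero
    r : Carrier
    r = dot b x * w
    x′ : Vector k
    x′ = (1# ·ᵥ x) +ᵥ ((- r) ·ᵥ y₀)

    lift : InSpanFam (ys ∘ suc) x′ → InSpanFam ys x
    lift (cs , x′≈) = (λ { zero → r ; (suc i) → cs i }) , λ t → begin
      x t                          ≈⟨ sub-cancel (x t) (r * y₀ t) ⟨
      r * y₀ t + (1# * x t + - (r * y₀ t))  ≈⟨ +-cong refl (+-cong refl (-‿distribˡ-* r (y₀ t))) ⟩
      r * y₀ t + x′ t              ≈⟨ +-cong refl (x′≈ t) ⟩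
      r * y₀ t + ∑ (λ i → cs i * ys (suc i) t)  ∎

    separate : ∃ (λ b′ → Separates b′ (ys ∘ suc) x′) → ∃ λ b″ → Separates b″ ys x
    separate (b′ , b′⊥ys′ , b′·x′≉0) = b″ , b″⊥ys , b″·x≉0
      where
      μ : Carrier
      μ = dot b′ y₀ * w
      b″ : Vector k
      b″ = (1# ·ᵥ b′) +ᵥ ((- μ) ·ᵥ b)

      μb·y₀≈b′·y₀ : μ * dot b y₀ ≈ 1# * dot b′ y₀
      μb·y₀≈b′·y₀ = begin
        (dot b′ y₀ * w) * dot b y₀
          ≈⟨ solve 3 (λ x w y → (x :* w) :* y := x :* (y :* w)) refl _ _ _ ⟩
        dot b′ y₀ * (dot b y₀ * w)  ≈⟨ *-cong refl b·y₀w≈1 ⟩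
        dot b′ y₀ * 1#              ≈⟨ *-comm _ _ ⟩
        1# * dot b′ y₀              ∎

      b″⊥ys : ∀ i → dot b″ (ys i) ≈ 0#
      b″⊥ys zero = begin
        dot b″ y₀                                ≈⟨ dot-linearˡ b′ b y₀ 1# (- μ) ⟩
        1# * dot b′ y₀ + - μ * dot b y₀          ≈⟨ +-cong refl (-‿distribˡ-* μ (dot b y₀)) ⟨
        1# * dot b′ y₀ + - (μ * dot b y₀)        ≈⟨ x≈y⇒x∙y⁻¹≈ε (sym μb·y₀≈b′·y₀) ⟩
        0#                                       ∎
      b″⊥ys (suc i) = begin
        dot b″ (ys (suc i))
          ≈⟨ dot-linearˡ b′ b _ 1# (- μ) ⟩
        1# * dot b′ (ys (suc i)) + - μ * dot b (ys (suc i))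
          ≈⟨ +-cong (*-cong refl (b′⊥ys′ i)) (*-cong refl (b⊥ys′ i)) ⟩
        1# * 0# + - μ * 0#
          ≈⟨ solve 2 (λ x y → x :* con 0 :+ y :* con 0 := con 0) refl 1# (- μ) ⟩
        0#  ∎

      b″·x≉0 : ¬ dot b″ x ≈ 0#
      b″·x≉0 b″·x≈0 = b′·x′≉0 (begin
        dot b′ x′                                ≈⟨ dot-linearʳ b′ x y₀ 1# (- r) ⟩
        1# * dot b′ x + - r * dot b′ y₀          ≈⟨ +-cong refl (-‿distribˡ-* r _) ⟨
        1# * dot b′ x + - (r * dot b′ y₀)
          ≈⟨ +-cong refl (-‿cong (solve 3 (λ x w y → (x :* w) :* y := (y :* w) :* x) refl _ _ _)) ⟩
        1# * dot b′ x + - (μ * dot b x)          ≈⟨ +-cong refl (-‿distribˡ-* μ _) ⟩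
        1# * dot b′ x + - μ * dot b x            ≈⟨ dot-linearˡ b′ b x 1# (- μ) ⟨
        dot b″ x                                 ≈⟨ b″·x≈0 ⟩
        0#                                       ∎)

  inSpan⊎separated : ∀ {k} m (ys : Fin m → Vector k) x → InSpanFam ys x ⊎ ∃ λ b → Separates b ys x
  inSpan⊎separated ℕ.zero ys x with any? (λ t → ¬? (x t ≟ 0#))
  ... | yes (t , xₜ≉0) =
    inj₂ (unitVector t , (λ ()) , λ e → xₜ≉0 (trans (sym (dot-unitVector t x)) e))
  ... | no ∄xₜ≉0 = inj₁ ((λ ()) , λ t → decidable-stable (x t ≟ 0#) (λ xₜ≉0 → ∄xₜ≉0 (t , xₜ≉0)))
  inSpan⊎separated (ℕ.suc m) ys x with inSpan⊎separated m (ys ∘ suc) x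
  ... | inj₁ (cs , x≈) =
    inj₁ ((λ { zero → 0# ; (suc i) → cs i }) ,
          λ t → trans (x≈ t) (sym (trans (+-cong (zeroˡ _) refl) (+-identityˡ _))))
  ... | inj₂ (b , b⊥ys′ , b·x≉0) with dot b (ys zero) ≟ 0#
  ...   | yes b⊥y₀   = inj₂ (b , (λ { zero → b⊥y₀ ; (suc i) → b⊥ys′ i }) , b·x≉0)
  ...   | no b·y₀≉0 = inSpan⊎separated-step ys b b⊥ys′ b·y₀≉0 (inSpan⊎separated m (ys ∘ suc)) x

  LinIndep⇒IsPointˡ : ∀ {k} {a b : Vector k} → LinIndep a b → IsPoint a
  LinIndep⇒IsPointˡ {a = a} {b} indep a≈0 = 1≉0 (proj₁ (indep 1# 0# λ t → begin
    1# * a t + 0# * b t  ≈⟨ +-cong (*-cong refl (a≈0 t)) refl ⟩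
    1# * 0# + 0# * b t   ≈⟨ solve 1 (λ y → con 1 :* con 0 :+ con 0 :* y := con 0) refl (b t) ⟩
    0#                   ∎))

  separated⇒LinIndep : ∀ {k} {a b x : Vector k} → IsPoint a → dot a x ≈ 0# → ¬ dot b x ≈ 0# →
                       LinIndep a b
  separated⇒LinIndep {a = a} {b} {x} a≉0 a·x≈0 b·x≉0 α β αa+βb≈0 = α≈0 , β≈0
    where
    β≈0 : β ≈ 0#
    β≈0 = *-cancelˡ⁻ b·x≉0 (begin
      β * dot b x                   ≈⟨ solve 2 (λ β y → β :* y := con 0 :+ β :* y) refl β _ ⟩
      0# + β * dot b x              ≈⟨ +-cong (trans (*-cong refl a·x≈0) (zeroʳ α)) refl ⟨
      α * dot a x + β * dot b x     ≈⟨ dot-linearˡ a b x α β ⟨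
      dot ((α ·ᵥ a) +ᵥ (β ·ᵥ b)) x  ≈⟨ dot-zeroˡ x αa+βb≈0 ⟩
      0#                            ≈⟨ zeroʳ β ⟨
      β * 0#                        ∎)
    α≈0 : α ≈ 0#
    α≈0 = decidable-stable (α ≟ 0#) λ α≉0 → a≉0 λ t → *-cancelˡ-≈0 α≉0 (begin
      α * a t               ≈⟨ +-identityʳ _ ⟨
      α * a t + 0#          ≈⟨ +-cong refl (trans (*-cong β≈0 refl) (zeroˡ (b t))) ⟨
      α * a t + β * b t     ≈⟨ αa+βb≈0 t ⟩
      0#                    ∎)

  LinePt-sym : ∀ {k} {u w x : Vector k} → LinePt u w x → LinePt w u x
  LinePt-sym (x≉0 , α , β , x≈) = x≉0 , β , α , λ t → trans (x≈ t) (+-comm _ _)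

  lineThrough : ∀ {n k} → (Fin n → Vector k) → Fin n × Fin n → PointSet k
  lineThrough P (i , j) = LinePt (P i) (P j)

  unionOfLines : ∀ {n m k} → (Fin n → Vector k) → (Fin m → Fin n × Fin n) → PointSet k
  unionOfLines P ends x = ∃ λ t → lineThrough P (ends t) x

  LinePt-meets-HyperplanePt : ∀ {k} {u w : Vector k} → IsPoint u → ¬ SamePoint u w →
                              ∀ a → Meets (LinePt u w) (HyperplanePt a)
  LinePt-meets-HyperplanePt {k} {u} {w} u≉0 u≁w a with dot a u ≟ 0#
  ... | yes a·u≈0 = u , (u≉0 , 1# , 0# , λ t →
          solve 2 (λ x y → x := con 1 :* x :+ con 0 :* y) refl (u t) (w t)) , (u≉0 , a·u≈0)
  ... | no a·u≉0 = z , (z≉0 , dot a w , - dot a u , λ t → refl) , (z≉0 , a·z≈0)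
    where
    z : Vector k
    z = (dot a w ·ᵥ u) +ᵥ ((- dot a u) ·ᵥ w)

    a·z≈0 : dot a z ≈ 0#
    a·z≈0 = begin
      dot a z                                      ≈⟨ dot-linearʳ a u w _ _ ⟩
      dot a w * dot a u + - dot a u * dot a w      ≈⟨ +-cong refl (-‿distribˡ-* _ _) ⟨
      dot a w * dot a u + - (dot a u * dot a w)    ≈⟨ x≈y⇒x∙y⁻¹≈ε (*-comm _ _) ⟩
      0#                                           ∎

    z≉0 : IsPoint z
    z≉0 z≈0 with inverse (dot a u) a·u≉0
    ... | v , a·u·v≈1 = u≁w (v * dot a w , λ t → *-cancelˡ a·u≉0 (begin
      dot a u * w t
        ≈⟨ sym (x∙y⁻¹≈ε⇒x≈y _ _ (trans (+-cong refl (-‿distribˡ-* _ _)) (z≈0 t))) ⟩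
      dot a w * u t                    ≈⟨ *-identityˡ _ ⟨
      1# * (dot a w * u t)             ≈⟨ *-cong a·u·v≈1 refl ⟨
      (dot a u * v) * (dot a w * u t)
        ≈⟨ solve 4 (λ A v W U → (A :* v) :* (W :* U) := A :* ((v :* W) :* U)) refl _ _ _ _ ⟩
      dot a u * ((v * dot a w) * u t)  ∎))

  LinePt-misses-Codim2Pt : ∀ {k} {a b u w : Vector k} →
                           ¬ (dot a u , dot b u) ∥ (dot a w , dot b w) →
                           ¬ Meets (LinePt u w) (Codim2Pt a b)
  LinePt-misses-Codim2Pt {a = a} {b} {u} {w} ¬∥ (x , (x≉0 , α , β , x≈) , (_ , a·x≈0 , b·x≈0)) =
    x≉0 λ t → begin
      x t                  ≈⟨ x≈ t ⟩
      α * u t + β * w t    ≈⟨ +-cong (*-cong α≈0 refl) (*-cong β≈0 refl) ⟩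
      0# * u t + 0# * w t  ≈⟨ solve 2 (λ x y → con 0 :* x :+ con 0 :* y := con 0) refl (u t) (w t) ⟩
      0#                   ∎
    where
    vanishes : ∀ h → dot h x ≈ 0# → α * dot h u + β * dot h w ≈ 0#
    vanishes h h·x≈0 = trans (sym (dot-linearʳ h u w α β)) (trans (dot-congʳ h (sym ∘ x≈)) h·x≈0)
    α≈0 : α ≈ 0#
    α≈0 = proj₁ (¬∥⇒trivialCombination ¬∥ (vanishes a a·x≈0) (vanishes b b·x≈0))
    β≈0 : β ≈ 0#
    β≈0 = proj₂ (¬∥⇒trivialCombination ¬∥ (vanishes a a·x≈0) (vanishes b b·x≈0))

  LinePt-representative : ∀ {k} {u w x : Vector k} → LinePt u w x →
    SamePoint u x ⊎ SamePoint w x ⊎ ∃ λ γ → ¬ γ ≈ 0# × SamePoint (w +ᵥ (γ ·ᵥ u)) x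
  LinePt-representative {u = u} {w} {x} (_ , α , β , x≈) with β ≟ 0# | α ≟ 0#
  ... | yes β≈0 | _ = inj₁ (α , λ t → begin
    x t                ≈⟨ x≈ t ⟩
    α * u t + β * w t  ≈⟨ +-cong refl (trans (*-cong β≈0 refl) (zeroˡ _)) ⟩
    α * u t + 0#       ≈⟨ +-identityʳ _ ⟩
    α * u t            ∎)
  ... | no _ | yes α≈0 = inj₂ (inj₁ (β , λ t → begin
    x t                ≈⟨ x≈ t ⟩
    α * u t + β * w t  ≈⟨ +-cong (trans (*-cong α≈0 refl) (zeroˡ _)) refl ⟩
    0# + β * w t       ≈⟨ +-identityˡ _ ⟩
    β * w t            ∎))
  ... | no β≉0 | no α≉0 with inverse β β≉0
  ...   | v , βv≈1 = inj₂ (inj₂ (α * v , αv≉0 , β , λ t → begin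
    x t                          ≈⟨ x≈ t ⟩
    α * u t + β * w t
      ≈⟨ solve 4 (λ α β U W → α :* U :+ β :* W := β :* W :+ con 1 :* (α :* U)) refl α β _ _ ⟩
    β * w t + 1# * (α * u t)
      ≈⟨ +-cong refl (*-cong βv≈1 refl) ⟨
    β * w t + (β * v) * (α * u t)
      ≈⟨ solve 5 (λ α β v U W → β :* W :+ (β :* v) :* (α :* U) := β :* (W :+ (α :* v) :* U))
               refl α β v _ _ ⟩
    β * (w t + (α * v) * u t)  ∎))
    where
    αv≉0 : ¬ α * v ≈ 0#
    αv≉0 αv≈0 = α≉0 (begin
      α             ≈⟨ *-identityʳ α ⟨
      α * 1#        ≈⟨ *-cong refl βv≈1 ⟨
      α * (β * v)   ≈⟨ solve 3 (λ α β v → α :* (β :* v) := (α :* v) :* β) refl α β v ⟩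
      (α * v) * β   ≈⟨ *-cong αv≈0 refl ⟩
      0# * β        ≈⟨ zeroˡ β ⟩
      0#            ∎)

  SamePoint-respˡ : ∀ {k} {r r′ x : Vector k} → r ≈ᵥ r′ → SamePoint r′ x → SamePoint r x
  SamePoint-respˡ r≈r′ (α , x≈αr′) = α , λ t → trans (x≈αr′ t) (*-cong refl (sym (r≈r′ t)))

  pencil : ∀ {k} → Vector k → Vector k → Vector k → Vector k
  pencil a b v = (dot b v ·ᵥ a) +ᵥ ((- dot a v) ·ᵥ b)

  pencil-vanishes : ∀ {k} {a b v x : Vector k} → (dot a v , dot b v) ∥ (dot a x , dot b x) →
                    dot (pencil a b v) x ≈ 0#
  pencil-vanishes {a = a} {b} {v} {x} v∥x = begin
    dot (pencil a b v) x                       ≈⟨ dot-linearˡ a b x _ _ ⟩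
    dot b v * dot a x + - dot a v * dot b x    ≈⟨ +-cong refl (-‿distribˡ-* _ _) ⟨
    dot b v * dot a x + - (dot a v * dot b x)  ≈⟨ x≈y⇒x∙y⁻¹≈ε (trans (*-comm _ _) (sym v∥x)) ⟩
    0#                                         ∎

  pencil-IsPoint : ∀ {k} {a b v : Vector k} → LinIndep a b → NonzeroPair (dot a v , dot b v) →
                   IsPoint (pencil a b v)
  pencil-IsPoint {a = a} {b} {v} indep v≉0 pencil≈0 with indep (dot b v) (- dot a v) pencil≈0
  ... | b·v≈0 , -a·v≈0 = v≉0 (⁻¹-injective (trans -a·v≈0 (sym ε⁻¹≈ε)) , b·v≈0)

  nonzeroElement : Fin (q ∸ 1) → Carrier
  nonzeroElement = punchedIn (proj₁ (enum-surj 0#)) enum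

  nonzeroElement-surjective : ∀ γ → ¬ γ ≈ 0# → ∃ λ g → nonzeroElement g ≈ γ
  nonzeroElement-surjective γ γ≉0 =
    let (i , enumᵢ≈γ) = enum-surj γ
        (g , eq) = punchedIn-covers i₀ enum λ i₀≡i → γ≉0 (begin
                     γ           ≈⟨ enumᵢ≈γ ⟨
                     enum i      ≡⟨ ≡.cong enum i₀≡i ⟨
                     enum i₀     ≈⟨ enum-i₀≈0 ⟩
                     0#          ∎)
    in g , trans (reflexive eq) enumᵢ≈γ
    where
    i₀ : Fin q
    i₀ = proj₁ (enum-surj 0#)
    enum-i₀≈0 : enum i₀ ≈ 0#
    enum-i₀≈0 = proj₂ (enum-surj 0#)

  AtMostPoints-⊆ : ∀ {k N} {B B′ : PointSet k} → B ⊆ B′ → AtMostPoints B′ N → AtMostPoints B N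
  AtMostPoints-⊆ B⊆B′ (reps , covers) = reps , λ x → covers x ∘ B⊆B′

  unionOfLines-atMost : ∀ {n m k} (P : Fin n → Vector k) (ends : Fin m → Fin n × Fin n) →
                        AtMostPoints (unionOfLines P ends) (n ℕ.+ (q ∸ 1) ℕ.* m)
  unionOfLines-atMost {n} {m} {k} P ends = P VF.++ VF.concat secant , covered
    where
    secant : Fin (q ∸ 1) → Fin m → Vector k
    secant g t = P (proj₂ (ends t)) +ᵥ (nonzeroElement g ·ᵥ P (proj₁ (ends t)))

    covered : ∀ x → unionOfLines P ends x → ∃ λ r → SamePoint ((P VF.++ VF.concat secant) r) x
    covered x (t , x∈ℓ) with LinePt-representative x∈ℓ
    ... | inj₁ same = proj₁ (ends t) ↑ˡ _ ,
          ≡.subst (λ r → SamePoint r x) (≡.sym (lookup-++ˡ P _ _)) same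
    ... | inj₂ (inj₁ same) = proj₂ (ends t) ↑ˡ _ ,
          ≡.subst (λ r → SamePoint r x) (≡.sym (lookup-++ˡ P _ _)) same
    ... | inj₂ (inj₂ (γ , γ≉0 , same)) with nonzeroElement-surjective γ γ≉0
    ...   | g , g≈γ = n ↑ʳ Fin.combine g t ,
          ≡.subst (λ r → SamePoint r x)
                  (≡.sym (≡.trans (lookup-++ʳ P _ _) (lookup-concat secant g t)))
                  (SamePoint-respˡ (λ s → +-cong refl (*-cong g≈γ refl)) same)

  StrongBlocking-⊆ : ∀ {k} {B B′ : PointSet k} → B ⊆ B′ → StrongBlocking B → StrongBlocking B′
  StrongBlocking-⊆ B⊆B′ blocking a a≉0 x x∈H with blocking a a≉0 x x∈H
  ... | m , ys , ys∈B∩H , x∈span =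
    m , ys , (λ i → B⊆B′ (proj₁ (ys∈B∩H i)) , proj₂ (ys∈B∩H i)) , x∈span

  avoidance⇒strongBlocking : ∀ {k m} (u w : Fin m → Vector k) →
    (∀ t → IsPoint (u t)) → (∀ t → ¬ SamePoint (u t) (w t)) →
    Avoidance (λ t → LinePt (u t) (w t)) → StrongBlocking (λ x → ∃ λ t → LinePt (u t) (w t) x)
  avoidance⇒strongBlocking {k} {m} u w u≉0 u≁w avoids a a≉0 x (x≉0 , a·x≈0) =
    spanned (λ t → LinePt-meets-HyperplanePt (u≉0 t) (u≁w t) a)
    where
    spanned : (∀ t → Meets (LinePt (u t) (w t)) (HyperplanePt a)) →
              InSpan (λ y → (∃ λ t → LinePt (u t) (w t) y) × HyperplanePt a y) x
    spanned meets with inSpan⊎separated m (proj₁ ∘ meets) x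
    ... | inj₁ x∈span =
      m , proj₁ ∘ meets , (λ t → (t , proj₁ (proj₂ (meets t))) , proj₂ (proj₂ (meets t))) , x∈span
    ... | inj₂ (b , b⊥z , b·x≉0) with avoids a b (separated⇒LinIndep a≉0 a·x≈0 b·x≉0)
    ...   | t , misses =
      let (z , z∈ℓ , z≉0 , a·z≈0) = meets t in ⊥-elim (misses (z , z∈ℓ , z≉0 , a·z≈0 , b⊥z t))

  module _ {n k m} (P : Fin n → Vector k) (G : Graph n)
           (fewOnHyperplanes : ∀ h → IsPoint h → hypCount P h ≤ m)
           (integrity : IntegrityAtLeast G (suc m)) where

    vanishingSet-≤ : ∀ {h} → IsPoint h → (X : Subset n) →
                     (∀ {i} → i ∈ X → dot h (P i) ≈ 0#) → ∣ X ∣ ≤ m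
    vanishingSet-≤ {h} h≉0 X X⊆H =
      ≤-trans (∣p∣≤length-filter (λ i → dot h (P i) ≟ 0#) id X X⊆H) (fewOnHyperplanes h h≉0)

    module _ {a b : Vector k} (indep : LinIndep a b) where
      coords : Fin n → Carrier × Carrier
      coords i = dot a (P i) , dot b (P i)

      onAxis : Subset n
      onAxis = subset (λ i → (dot a (P i) ≟ 0#) ×-dec (dot b (P i) ≟ 0#))

      componentHyperplane : (∀ {i j} → T (adj G i j) → coords i ∥ coords j) →
        ∀ {v C} → (∀ u → u ∈ C → InComponent G onAxis v u) →
        ∃ λ h → IsPoint h × (∀ {i} → i ∈ onAxis ∪ C → dot h (P i) ≈ 0#)
      componentHyperplane collinear {v} {C} C⊆comp with (dot a (P v) ≟ 0#) ×-dec (dot b (P v) ≟ 0#)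
      ... | yes v∈axis = a , LinIndep⇒IsPointˡ indep , a-vanishes
        where
        a-vanishes : ∀ {i} → i ∈ onAxis ∪ C → dot a (P i) ≈ 0#
        a-vanishes {i} i∈ with x∈p∪q⁻ onAxis C i∈
        ... | inj₁ i∈axis = proj₁ (∈-subset⁻ _ i∈axis)
        ... | inj₂ i∈C = ⊥-elim (proj₁ (C⊆comp i i∈C) (∈-subset⁺ _ v∈axis))
      ... | no v∉axis = pencil a b (P v) , pencil-IsPoint indep v∉axis , pencil-vanishes-on
        where
        parallel : ∀ {i} → i ∈ onAxis ∪ C → coords v ∥ coords i
        parallel {i} i∈ with x∈p∪q⁻ onAxis C i∈
        ... | inj₁ i∈axis = let (a·Pᵢ≈0 , b·Pᵢ≈0) = ∈-subset⁻ _ i∈axis in ∥-zero _ a·Pᵢ≈0 b·Pᵢ≈0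
        ... | inj₂ i∈C = Star-preserves {Q = λ j → coords v ∥ coords j} step (proj₂ (C⊆comp i i∈C))
                                        refl
          where
          step : ∀ {j l} → StepOutside G onAxis j l → coords v ∥ coords j → coords v ∥ coords l
          step (j∉axis , _ , adj-jl) v∥j = ∥-trans (j∉axis ∘ ∈-subset⁺ _) v∥j (collinear adj-jl)

        pencil-vanishes-on : ∀ {i} → i ∈ onAxis ∪ C → dot (pencil a b (P v)) (P i) ≈ 0#
        pencil-vanishes-on {i} i∈ = pencil-vanishes {a = a} {b} {P v} {P i} (parallel i∈)

      collinearEdges-impossible : ¬ (∀ {i j} → T (adj G i j) → coords i ∥ coords j)
      collinearEdges-impossible collinear with integrity onAxis
      ... | t , m<∣S∣+t , inj₁ ≡.refl =
        ≤⇒≯ (vanishingSet-≤ (LinIndep⇒IsPointˡ indep) onAxis (proj₁ ∘ ∈-subset⁻ _))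
            (≡.subst (suc m ≤_) (ℕₚ.+-identityʳ _) m<∣S∣+t)
      ... | t , m<∣S∣+t , inj₂ (v , C , t≤∣C∣ , C⊆comp) =
        let (h , h≉0 , h⊥) = componentHyperplane collinear C⊆comp in
        ≤⇒≯ (vanishingSet-≤ h≉0 (onAxis ∪ C) h⊥)
            (≤-trans m<∣S∣+t (≤-trans (+-monoʳ-≤ ∣ onAxis ∣ t≤∣C∣)
                                      (ℕₚ.≤-reflexive (≡.sym (∣p∪q∣≡∣p∣+∣q∣ onAxis C disjoint)))))
        where
        disjoint : Empty (onAxis ∩ C)
        disjoint (i , i∈S∩C) = let (i∈S , i∈C) = x∈p∩q⁻ onAxis C i∈S∩C in
                               InComponent⇒∉ G (C⊆comp i i∈C) i∈S

      someEdgeMisses : ∃ λ (e : Edge G) → ¬ Meets (lines P G e) (Codim2Pt a b)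
      someEdgeMisses with any? (λ i → any? (λ j → T? (adj G i j) ×-dec ¬? (coords i ∥? coords j)))
      ... | yes (i , j , adj-ij , ¬∥) = (i , j , adj-ij) , LinePt-misses-Codim2Pt ¬∥
      ... | no none = ⊥-elim (collinearEdges-impossible λ {i} {j} adj-ij →
                        decidable-stable (coords i ∥? coords j) (λ ¬∥ → none (i , j , adj-ij , ¬∥)))

    avoidance : Avoidance (lines P G)
    avoidance a b indep = someEdgeMisses indep

  module _ {n k} (P : Fin n → Vector k) (G : Graph n) where
    edgeEnds : Fin (numEdges G) → Fin n × Fin n
    edgeEnds = List.lookup (edgeList G)

    edgeEnds-adj : ∀ t → T (adj G (proj₁ (edgeEnds t)) (proj₂ (edgeEnds t)))
    edgeEnds-adj t = edgeList-adj G (∈-lookup t)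

    unionOfLines⊆blockSet : unionOfLines P edgeEnds ⊆ blockSet P G
    unionOfLines⊆blockSet (t , x∈ℓ) =
      (proj₁ (edgeEnds t) , proj₂ (edgeEnds t) , edgeEnds-adj t) , x∈ℓ

    ∈-edgeList⇒listed : ∀ {e} → e ∈ₗ edgeList G →
                        ∃ λ t → lineThrough P e ≐ lineThrough P (edgeEnds t)
    ∈-edgeList⇒listed e∈E =
      index e∈E , ≡.subst (λ e′ → lineThrough P _ ⊆ lineThrough P e′) (lookup-index e∈E) id
                , ≡.subst (λ e′ → lineThrough P e′ ⊆ lineThrough P _) (lookup-index e∈E) id

    lines-listed : ∀ (e : Edge G) → ∃ λ t → lines P G e ≐ lineThrough P (edgeEnds t)
    lines-listed (i , j , adj-ij) with <-cmp i j
    ... | tri< i<j _ _ = ∈-edgeList⇒listed (∈-edgeList G i<j adj-ij)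
    ... | tri≈ _ i≡j _ = ⊥-elim (adj⇒≢ G adj-ij i≡j)
    ... | tri> _ _ j<i =
      let (t , ⊆ℓ , ℓ⊆) = ∈-edgeList⇒listed (∈-edgeList G j<i (≡.subst T (adj-sym G i j) adj-ij)) in
      t , ⊆ℓ ∘ LinePt-sym , LinePt-sym ∘ ℓ⊆

    blockSet⊆unionOfLines : blockSet P G ⊆ unionOfLines P edgeEnds
    blockSet⊆unionOfLines (e , x∈ℓ) = let (t , ⊆ℓ , _) = lines-listed e in t , ⊆ℓ x∈ℓ

    listedLines-avoidance : Avoidance (lines P G) → Avoidance (lineThrough P ∘ edgeEnds)
    listedLines-avoidance avoids a b indep =
      let (e , misses) = avoids a b indep
          (t , _ , ℓ⊆) = lines-listed e
      in t , λ (x , x∈ℓ , x∈C) → misses (x , ℓ⊆ x∈ℓ , x∈C)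

open import Data.Nat using (_+_; _*_)
open Defs using (Vector; ProjSystem; Avoidance; lines; StrongBlocking; blockSet; AtMostPoints)

lemma4p4 : ∀ {c : Level} (F : FiniteField c c) (n k d : ℕ)
           (P : Fin n → Vector F k) (G : Graph n) →
           ProjSystem F n k d P →
           IntegrityAtLeast G (n ∸ d + 1) →
           Avoidance F (lines F P G)
           × StrongBlocking F (blockSet F P G)
           × AtMostPoints F (blockSet F P G) (n + (FiniteField.q F ∸ 1) * numEdges G)
lemma4p4 F n k d P G M ι = avoids , blocking , atMost
  where
  open ProjSystem M
  ends : Fin (numEdges G) → Fin n × Fin n
  ends = edgeEnds F P G
  avoids : Avoidance F (lines F P G)
  avoids = avoidance F P G (λ h h≉0 → m+n≤o⇒m≤o∸n _ (maxBound h h≉0))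
                           (≡.subst (IntegrityAtLeast G) (ℕₚ.+-comm (n ∸ d) 1) ι)
  blocking : StrongBlocking F (blockSet F P G)
  blocking = StrongBlocking-⊆ F {B = unionOfLines F P ends} (unionOfLines⊆blockSet F P G)
    (avoidance⇒strongBlocking F (P ∘ proj₁ ∘ ends) (P ∘ proj₂ ∘ ends) (points ∘ proj₁ ∘ ends)
      (λ t → distinct _ _ (adj⇒≢ G (edgeEnds-adj F P G t)))
      (listedLines-avoidance F P G avoids))
  atMost : AtMostPoints F (blockSet F P G) (n + (FiniteField.q F ∸ 1) * numEdges G)
  atMost = AtMostPoints-⊆ F (blockSet⊆unionOfLines F P G) (unionOfLines-atMost F P ends)
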